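{- Let $k\ge1$ be an integer and let $P(x,y)=\sum_{n\ge0}\sum_{\pi\in\mathcal{S}_n}y^{e(\pi)}x^n/n!$, where $e(\pi)$ is the number of occurrences of the segmented pattern $aa_1a_2\cdots a_k$ in $\pi$. Then $P$ is the solution of $$\frac{\partial P}{\partial x}=yP^2+\frac{(1-y)(1-x^k)}{1-x}P$$ with the initial condition $P(0,y)=1$.
   Context: $\mathcal{S}_n$ is the set of permutations of $\{1,\dots,n\}$ written as words $\pi_1\cdots\pi_n$ ($\mathcal{S}_0$ contains only the empty permutation). An occurrence of the segmented pattern $aa_1\cdots a_k$ (built on the poset with only relations $a<a_i$) in $\pi\in\mathcal{S}_n$ is an index $i$ with $i+k\le n$ such that $\pi_i<\pi_{i+t}$ for all $t=1,\dots,k$. -}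

module Defs where

open import Data.Nat as ℕ using (ℕ; zero; suc; _∸_; _<_; _≤_; _<?_; _≤?_; _!)
open import Data.Nat.Properties using (_!≢0)
open import Data.Integer using (+_)
open import Data.List using (List; []; _∷_; map; concatMap; filter; length; take; upTo; foldr)
open import Data.List.Relation.Unary.All using (All; all?)
open import Data.List.Membership.DecPropositional ℕ._≟_ using (_∈?_)
open import Data.Rational using (ℚ; 0ℚ; 1ℚ; _/_; _+_; _*_; _-_)
open import Relation.Nullary using (yes; no)
open import Relation.Nullary.Decidable using (⌊_⌋)
open import Relation.Nullary.Decidable.Core using (_×-dec_)
open import Data.Bool using (if_then_else_)

range : ℕ → List ℕ
range n = map suc (upTo n)

words : ℕ → List ℕ → List (List ℕ)
words zero    alph = [] ∷ []
words (suc m) alph = concatMap (λ a → map (a ∷_) (words m alph)) alph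

-- 𝒮ₙ : the words of length n over {1..n} in which every letter 1..n occurs
-- (exactly the permutations of {1,…,n}; 𝒮₀ = { empty word })
S : ℕ → List (List ℕ)
S n = filter (λ w → all? (λ i → i ∈? w) (range n)) (words n (range n))

-- Occurrences of the segmented pattern a a₁ ⋯ a_k (only relations a < aᵢ):
-- indices i with i + k ≤ n and πᵢ < π_{i+t} for t = 1..k.

occ : ℕ → List ℕ → ℕ
occ k []         = 0
occ k (a ∷ rest) with k ≤? length rest ×-dec all? (a <?_) (take k rest)
... | yes _ = suc (occ k rest)
... | no  _ = occ k rest

-- Formal power series in x and y over ℚ:  F n j = coefficient of xⁿ yʲ.

FPS₂ : Set
FPS₂ = ℕ → ℕ → ℚ

Σ≤ : ℕ → (ℕ → ℚ) → ℚ
Σ≤ n f = foldr (λ i acc → f i + acc) 0ℚ (upTo (suc n))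

_⊕_ : FPS₂ → FPS₂ → FPS₂
(F ⊕ G) n j = F n j + G n j

_⊖_ : FPS₂ → FPS₂ → FPS₂
(F ⊖ G) n j = F n j - G n j

_⊛_ : FPS₂ → FPS₂ → FPS₂
(F ⊛ G) n j = Σ≤ n (λ a → Σ≤ j (λ b → F a b * G (n ∸ a) (j ∸ b)))

𝟙 : FPS₂
𝟙 zero zero = 1ℚ
𝟙 _    _    = 0ℚ

𝕪 : FPS₂
𝕪 zero (suc zero) = 1ℚ
𝕪 _    _          = 0ℚ

-- (1 - x^k)/(1 - x) = 1 + x + ⋯ + x^{k-1}
geomX : ℕ → FPS₂
geomX k n zero    = if ⌊ n <? k ⌋ then 1ℚ else 0ℚ
geomX k n (suc j) = 0ℚ

∂x : FPS₂ → FPS₂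
∂x F n j = (+ suc n / 1) * F (suc n) j

P : ℕ → FPS₂
P k n j = (+ length (filter (λ π → occ k π ℕ.≟ j) (S n)) / (n !)) {{n !≢0}}

atX0 : FPS₂ → ℕ → ℚ
atX0 F j = F 0 j

{-# OPTIONS --safe #-}
module Submission where

-- Write a permutation of {1,…,n+1} as σ 1 τ.  As 1 is smaller than every other letter, no window
-- starting in σ can reach past it, so e(σ 1 τ) = e(σ) + e(τ) + [|τ| ≥ k], the last term being the
-- occurrence that starts at 1.  The letters of τ form an arbitrary a-subset and e depends only on
-- the relative order of the letters, so with c(m) = Σ_{π ∈ S m} y^e(π)
--   c(n+1) = Σ_a C(n,a) y^[a ≥ k] c(a) c(n-a),
-- which for the exponential generating function P says ∂P/∂x = Q P, Q = Σ_m y^[m ≥ k] c(m) x^m/m!.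
-- Permutations of length m < k have no occurrence, so c(m) = m! there, and Q = y P + (1-y)(1 + ⋯ + x^(k-1)).

open import Defs
open import Algebra.Bundles using (CommutativeSemiring; CommutativeRing)
open import Data.Empty using (⊥-elim)
open import Data.List.Base using (List; []; _∷_; _++_; map; concatMap; length; take; upTo; foldr; applyUpTo)
open import Data.List.Properties
  using (++-assoc; ++-cancelʳ; length-++; length-++-≤ˡ; length-map; length-upTo; ∷-injectiveˡ; ∷-injectiveʳ)
open import Data.List.Membership.Propositional using (_∈_; _∉_; find; lose)
open import Data.List.Membership.Propositional.Properties
  using (∈-++⁺ˡ; ∈-++⁺ʳ; ∈-++⁻; ∈-map⁺; ∈-map⁻; ∈-concatMap⁺; ∈-concatMap⁻; ∈-∃++; ∈-filter⁺; ∈-filter⁻)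
open import Data.List.Membership.Propositional.Properties.WithK using (unique∧set⇒bag)
open import Data.List.Relation.Unary.Any using (here; there)
open import Data.List.Relation.Unary.All as All using (All; []; _∷_; all?)
import Data.List.Relation.Unary.All.Properties as All
open import Data.List.Relation.Unary.AllPairs as AllPairs using (AllPairs; []; _∷_)
import Data.List.Relation.Unary.AllPairs.Properties as AllPairs
open import Data.List.Relation.Unary.Unique.Propositional using (Unique)
import Data.List.Relation.Unary.Unique.Propositional.Properties as Unique
open import Data.List.Relation.Binary.Permutation.Propositional using (_↭_; ↭-refl; ↭-sym; ↭-trans; prep)
open import Data.List.Relation.Binary.Permutation.Propositional.Properties
  using (shift; drop-mid; drop-∷; ∈-resp-↭; ↭-empty-inv; ↭-length; ++⁺)
open import Data.List.Relation.Binary.BagAndSetEquality using (∼bag⇒↭)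
open import Data.Nat.Base as ℕ using (ℕ; zero; suc; _∸_; _<_; _≤_; z≤n; s≤s; _!; NonZero)
import Data.Nat.Properties as ℕ
open import Data.Nat.Properties
  using (_≟_; _≤?_; _<?_; <-irrefl; <-asym; <-trans; <⇒≢; <⇒≤; <⇒≱; ≮⇒≥; ≰⇒>; ≤-refl; ≤-reflexive; ≤-trans; ≤-<-trans;
         n≤1+n; n<1+n; m≤m+n; m≤n+m; m∸n≤m; suc-injective)
open import Data.List.Membership.DecPropositional _≟_ using (_∈?_)
open import Data.Nat.Combinatorics using (_C_)
open import Data.Product.Base using (_×_; _,_; proj₁; proj₂; ∃₂; map₁; map₂)
open import Data.Sum.Base using (inj₁; inj₂)
open import Function.Base using (_∘_)
open import Function.Bundles using (_⇔_; mk⇔; Equivalence)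
open import Relation.Nullary using (¬_; Dec; yes; no)
open import Relation.Nullary.Decidable.Core using (_×-dec_)
open import Relation.Binary.PropositionalEquality using (_≡_; _≢_; refl; sym; trans; cong; cong₂; subst; module ≡-Reasoning)

module RangeSum {c ℓ} (R : CommutativeSemiring c ℓ) where

  open CommutativeSemiring R renaming (refl to ≈-refl; sym to ≈-sym; trans to ≈-trans)
  open import Algebra.Properties.CommutativeSemigroup +-commutativeSemigroup using (interchange)
  open import Relation.Binary.Reasoning.Setoid setoid

  ∑< : ℕ → (ℕ → Carrier) → Carrier
  ∑< zero    f = 0#
  ∑< (suc n) f = f 0 + ∑< n (f ∘ suc)

  ∑<-cong : ∀ n {f g : ℕ → Carrier} → (∀ i → i < n → f i ≈ g i) → ∑< n f ≈ ∑< n g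
  ∑<-cong zero    f≈g = ≈-refl
  ∑<-cong (suc n) f≈g = +-cong (f≈g 0 (s≤s z≤n)) (∑<-cong n (λ i i<n → f≈g (suc i) (s≤s i<n)))

  ∑<-zero : ∀ n {f : ℕ → Carrier} → (∀ i → i < n → f i ≈ 0#) → ∑< n f ≈ 0#
  ∑<-zero zero    f≈0 = ≈-refl
  ∑<-zero (suc n) f≈0 = ≈-trans (+-cong (f≈0 0 (s≤s z≤n)) (∑<-zero n (λ i i<n → f≈0 (suc i) (s≤s i<n)))) (+-identityˡ 0#)

  ∑<-distrib-+ : ∀ n (f g : ℕ → Carrier) → ∑< n (λ i → f i + g i) ≈ ∑< n f + ∑< n g
  ∑<-distrib-+ zero    f g = ≈-sym (+-identityˡ 0#)
  ∑<-distrib-+ (suc n) f g = ≈-trans (+-congˡ (∑<-distrib-+ n (f ∘ suc) (g ∘ suc))) (interchange _ _ _ _)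

  *-distribʳ-∑< : ∀ n (f : ℕ → Carrier) x → ∑< n f * x ≈ ∑< n (λ i → f i * x)
  *-distribʳ-∑< zero    f x = zeroˡ x
  *-distribʳ-∑< (suc n) f x = ≈-trans (distribʳ x (f 0) _) (+-congˡ (*-distribʳ-∑< n (f ∘ suc) x))

  ∑<-init-last : ∀ n (f : ℕ → Carrier) → ∑< (suc n) f ≈ ∑< n f + f n
  ∑<-init-last zero    f = +-comm (f 0) 0#
  ∑<-init-last (suc n) f = begin
    f 0 + ∑< (suc n) (f ∘ suc)    ≈⟨ +-congˡ (∑<-init-last n (f ∘ suc)) ⟩
    f 0 + (∑< n (f ∘ suc) + f (suc n)) ≈⟨ +-assoc _ _ _ ⟨
    f 0 + ∑< n (f ∘ suc) + f (suc n)   ∎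

-- Rearrangements built around the minimum

concatMap-unique : ∀ {A B : Set} {g : A → List B} {xs} → Unique xs → (∀ {x} → x ∈ xs → Unique (g x)) →
                   (∀ {x x′ y} → x ∈ xs → x′ ∈ xs → y ∈ g x → y ∈ g x′ → x ≡ x′) → Unique (concatMap g xs)
concatMap-unique {xs = []}     _          _  _    = []
concatMap-unique {g = g} {xs = x ∷ xs} (x∉xs ∷ u) ug same =
  Unique.++⁺ (ug (here refl)) (concatMap-unique u (ug ∘ there) (λ p q → same (there p) (there q))) disjoint
  where
  disjoint : ∀ {y} → ¬ (y ∈ g x × y ∈ concatMap g xs)
  disjoint (y∈gx , y∈rest) with x′ , x′∈xs , y∈gx′ ← find (∈-concatMap⁻ g y∈rest) =
    All.lookup x∉xs x′∈xs (same (here refl) (there x′∈xs) y∈gx y∈gx′)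

module _ {A : Set} where

  splits : List A → List (List A × List A)
  splits []      = ([] , []) ∷ []
  splits (x ∷ L) = map (map₁ (x ∷_)) (splits L) ++ map (map₂ (x ∷_)) (splits L)

  data SplitsView (x : A) (L : List A) : List A → List A → Set where
    left  : ∀ {X Y} → (X , Y) ∈ splits L → SplitsView x L (x ∷ X) Y
    right : ∀ {X Y} → (X , Y) ∈ splits L → SplitsView x L X (x ∷ Y)

  splitsView : ∀ {x L X Y} → (X , Y) ∈ splits (x ∷ L) → SplitsView x L X Y
  splitsView {x} {L} p with ∈-++⁻ (map (map₁ (x ∷_)) (splits L)) p
  ... | inj₁ q with (X , Y) , XY∈ , refl ← ∈-map⁻ (map₁ (x ∷_)) q = left XY∈
  ... | inj₂ q with (X , Y) , XY∈ , refl ← ∈-map⁻ (map₂ (x ∷_)) q = right XY∈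

  ∈-splits-left : ∀ {x L X Y} → (X , Y) ∈ splits L → (x ∷ X , Y) ∈ splits (x ∷ L)
  ∈-splits-left {x} p = ∈-++⁺ˡ (∈-map⁺ (map₁ (x ∷_)) p)

  ∈-splits-right : ∀ {x L X Y} → (X , Y) ∈ splits L → (X , x ∷ Y) ∈ splits (x ∷ L)
  ∈-splits-right {x} {L} p = ∈-++⁺ʳ (map (map₁ (x ∷_)) (splits L)) (∈-map⁺ (map₂ (x ∷_)) p)

  splits-↭ : ∀ L {X Y} → (X , Y) ∈ splits L → X ++ Y ↭ L
  splits-↭ []      (here refl) = ↭-refl
  splits-↭ (x ∷ L) p with splitsView {x} {L} p
  ... | left  q = prep x (splits-↭ L q)
  ... | right {X} {Y} q = ↭-trans (shift x X Y) (prep x (splits-↭ L q))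

  ∈-splitsˡ : ∀ {L X Y z} → (X , Y) ∈ splits L → z ∈ X → z ∈ L
  ∈-splitsˡ {L} p z∈X = ∈-resp-↭ (splits-↭ L p) (∈-++⁺ˡ z∈X)

  ∈-splitsʳ : ∀ {L X Y z} → (X , Y) ∈ splits L → z ∈ Y → z ∈ L
  ∈-splitsʳ {L} {X} p z∈Y = ∈-resp-↭ (splits-↭ L p) (∈-++⁺ʳ X z∈Y)

  length-splitsˡ : ∀ {L X Y} → (X , Y) ∈ splits L → length X ≤ length L
  length-splitsˡ {L} {X} {Y} p =
    ≤-trans (m≤m+n (length X) (length Y)) (≤-reflexive (trans (sym (length-++ X)) (↭-length (splits-↭ L p))))

  length-splitsʳ : ∀ {L X Y} → (X , Y) ∈ splits L → length Y ≤ length L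
  length-splitsʳ {L} {X} {Y} p =
    ≤-trans (m≤n+m (length Y) (length X)) (≤-reflexive (trans (sym (length-++ X)) (↭-length (splits-↭ L p))))

  splits-AllPairs : ∀ {R : A → A → Set} L {X Y} → AllPairs R L → (X , Y) ∈ splits L → AllPairs R X × AllPairs R Y
  splits-AllPairs []      []          (here refl) = [] , []
  splits-AllPairs (x ∷ L) (Rx ∷ RL) p with splitsView {x} {L} p
  ... | left  q = let RX , RY = splits-AllPairs L RL q in (All.tabulate (All.lookup Rx ∘ ∈-splitsˡ q) ∷ RX) , RY
  ... | right q = let RX , RY = splits-AllPairs L RL q in RX , (All.tabulate (All.lookup Rx ∘ ∈-splitsʳ q) ∷ RY)

  splits-unique : ∀ L → Unique L → Unique (splits L)
  splits-unique []      _          = [] ∷ []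
  splits-unique (x ∷ L) (x∉L ∷ uL) =
    Unique.++⁺ (Unique.map⁺ injectiveˡ (splits-unique L uL)) (Unique.map⁺ injectiveʳ (splits-unique L uL)) disjoint
    where
    injectiveˡ : ∀ {p q : List A × List A} → map₁ (x ∷_) p ≡ map₁ (x ∷_) q → p ≡ q
    injectiveˡ {_ , _} {_ , _} refl = refl
    injectiveʳ : ∀ {p q : List A × List A} → map₂ (x ∷_) p ≡ map₂ (x ∷_) q → p ≡ q
    injectiveʳ {_ , _} {_ , _} refl = refl
    disjoint : ∀ {p} → ¬ (p ∈ map (map₁ (x ∷_)) (splits L) × p ∈ map (map₂ (x ∷_)) (splits L))
    disjoint (p , q) with _ , _ , refl ← ∈-map⁻ (map₁ (x ∷_)) p | _ , XY∈ , eq ← ∈-map⁻ (map₂ (x ∷_)) q =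
      All.lookup x∉L (∈-splitsˡ XY∈ (subst (x ∈_) (cong proj₁ eq) (here refl))) refl

  ↭-splits : ∀ σ τ {L} → σ ++ τ ↭ L → ∃₂ λ X Y → (X , Y) ∈ splits L × σ ↭ X × τ ↭ Y
  ↭-splits σ τ {[]} p with ↭-empty-inv p
  ↭-splits [] [] {[]} p | refl = [] , [] , here refl , ↭-refl , ↭-refl
  ↭-splits σ τ {x ∷ L} p with ∈-++⁻ σ (∈-resp-↭ (↭-sym p) (here refl))
  ... | inj₁ x∈σ with σ₁ , σ₂ , refl ← ∈-∃++ x∈σ
      with X , Y , XY∈ , σ↭X , τ↭Y ← ↭-splits (σ₁ ++ σ₂) τ (subst (_↭ L) (sym (++-assoc σ₁ σ₂ τ))
             (drop-mid σ₁ [] (subst (_↭ x ∷ L) (++-assoc σ₁ (x ∷ σ₂) τ) p)))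
      = x ∷ X , Y , ∈-splits-left {x} {L} XY∈ , ↭-trans (shift x σ₁ σ₂) (prep x σ↭X) , τ↭Y
  ... | inj₂ x∈τ with τ₁ , τ₂ , refl ← ∈-∃++ x∈τ
      with X , Y , XY∈ , σ↭X , τ↭Y ← ↭-splits σ (τ₁ ++ τ₂) (subst (_↭ L) (++-assoc σ τ₁ τ₂)
             (drop-mid (σ ++ τ₁) [] (subst (_↭ x ∷ L) (sym (++-assoc σ τ₁ (x ∷ τ₂))) p)))
      = X , x ∷ Y , ∈-splits-right {x} {L} XY∈ , σ↭X , ↭-trans (shift x τ₁ τ₂) (prep x τ↭Y)

Increasing : List ℕ → Set
Increasing = AllPairs _<_

increasing⇒unique : ∀ {xs} → Increasing xs → Unique xs
increasing⇒unique = AllPairs.map <⇒≢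

increasing-↭⇒≡ : ∀ {xs ys} → Increasing xs → Increasing ys → xs ↭ ys → xs ≡ ys
increasing-↭⇒≡ {[]}     _ _ p = sym (↭-empty-inv (↭-sym p))
increasing-↭⇒≡ {x ∷ xs} {[]} _ _ p with () ← ↭-empty-inv p
increasing-↭⇒≡ {x ∷ xs} {y ∷ ys} (x<xs ∷ ixs) (y<ys ∷ iys) p
  with ∈-resp-↭ p (here refl) | ∈-resp-↭ (↭-sym p) (here refl)
... | here refl  | _          = cong (x ∷_) (increasing-↭⇒≡ ixs iys (drop-∷ p))
... | there _    | here refl  = cong (x ∷_) (increasing-↭⇒≡ ixs iys (drop-∷ p))
... | there x∈ys | there y∈xs = ⊥-elim (<-asym (All.lookup x<xs y∈xs) (All.lookup y<ys x∈ys))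

++-∷-cancel : ∀ {A : Set} {m : A} σ σ′ {τ τ′} → m ∉ σ → m ∉ σ′ → σ ++ m ∷ τ ≡ σ′ ++ m ∷ τ′ → σ ≡ σ′ × τ ≡ τ′
++-∷-cancel []      []       _   _    refl = refl , refl
++-∷-cancel []      (_ ∷ _)  _   m∉σ′ refl = ⊥-elim (m∉σ′ (here refl))
++-∷-cancel (_ ∷ _) []       m∉σ _    refl = ⊥-elim (m∉σ (here refl))
++-∷-cancel (x ∷ σ) (_ ∷ σ′) m∉σ m∉σ′ eq with refl ← ∷-injectiveˡ eq =
  map₁ (cong (x ∷_)) (++-∷-cancel σ σ′ (m∉σ ∘ there) (m∉σ′ ∘ there) (∷-injectiveʳ eq))

joins : ℕ → List (List ℕ) → List (List ℕ) → List (List ℕ)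
joins m Σs Τs = concatMap (λ τ → map (λ σ → σ ++ m ∷ τ) Σs) Τs

∈-joins⁺ : ∀ {m Σs Τs σ τ} → σ ∈ Σs → τ ∈ Τs → σ ++ m ∷ τ ∈ joins m Σs Τs
∈-joins⁺ {m} {Σs} σ∈ τ∈ = ∈-concatMap⁺ (λ τ → map (λ σ → σ ++ m ∷ τ) Σs) (lose τ∈ (∈-map⁺ _ σ∈))

∈-joins⁻ : ∀ {m Σs Τs w} → w ∈ joins m Σs Τs → ∃₂ λ σ τ → σ ∈ Σs × τ ∈ Τs × w ≡ σ ++ m ∷ τ
∈-joins⁻ {m} {Σs} p with τ , τ∈ , q ← find (∈-concatMap⁻ (λ τ → map (λ σ → σ ++ m ∷ τ) Σs) p)
                    with σ , σ∈ , refl ← ∈-map⁻ _ q = σ , τ , σ∈ , τ∈ , refl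

joins-unique : ∀ {m Σs Τs} → Unique Σs → Unique Τs → (∀ {σ} → σ ∈ Σs → m ∉ σ) → Unique (joins m Σs Τs)
joins-unique {m} {Σs} {Τs} uΣ uΤ m∉ =
  concatMap-unique uΤ (λ {τ} _ → Unique.map⁺ (++-cancelʳ (m ∷ τ) _ _) uΣ) same
  where
  same : ∀ {τ τ′ w} → τ ∈ Τs → τ′ ∈ Τs → w ∈ map (λ σ → σ ++ m ∷ τ) Σs → w ∈ map (λ σ → σ ++ m ∷ τ′) Σs → τ ≡ τ′
  same _ _ p q with σ , σ∈ , refl ← ∈-map⁻ _ p | σ′ , σ′∈ , eq ← ∈-map⁻ _ q =
    proj₂ (++-∷-cancel σ σ′ (m∉ σ∈) (m∉ σ′∈) eq)

-- Rearrangements of m ∷ L as σ m τ with σ, τ rearrangements of the two parts of a split of L;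
-- the first argument is fuel, sufficient once length L ≤ f.
perms : ℕ → List ℕ → List (List ℕ)
perms f       []      = [] ∷ []
perms zero    (_ ∷ _) = []
perms (suc f) (m ∷ L) = concatMap (λ p → joins m (perms f (proj₁ p)) (perms f (proj₂ p))) (splits L)

data PermsView (f m : ℕ) (L : List ℕ) : List ℕ → Set where
  join : ∀ {X Y σ τ} → (X , Y) ∈ splits L → σ ∈ perms f X → τ ∈ perms f Y → PermsView f m L (σ ++ m ∷ τ)

permsView : ∀ {f m L w} → w ∈ perms (suc f) (m ∷ L) → PermsView f m L w
permsView {f} {m} {L} p
  with (X , Y) , XY∈ , q ← find (∈-concatMap⁻ (λ p → joins m (perms f (proj₁ p)) (perms f (proj₂ p))) {xs = splits L} p)
  with σ , τ , σ∈ , τ∈ , refl ← ∈-joins⁻ {m} q = join XY∈ σ∈ τ∈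

perms-sound : ∀ f L {w} → w ∈ perms f L → w ↭ L
perms-sound f       []      (here refl) = ↭-refl
perms-sound (suc f) (m ∷ L) p with permsView {f} {m} {L} p
... | join {X} {Y} {σ} {τ} XY∈ σ∈ τ∈ =
  ↭-trans (shift m σ τ) (prep m (↭-trans (++⁺ (perms-sound f X σ∈) (perms-sound f Y τ∈)) (splits-↭ L XY∈)))

perms-complete : ∀ f L {w} → length L ≤ f → w ↭ L → w ∈ perms f L
perms-complete f       []      _       p rewrite ↭-empty-inv p = here refl
perms-complete (suc f) (m ∷ L) (s≤s L≤f) p
  with σ , τ , refl ← ∈-∃++ (∈-resp-↭ (↭-sym p) (here refl))
  with X , Y , XY∈ , σ↭X , τ↭Y ← ↭-splits σ τ (drop-∷ (↭-trans (↭-sym (shift m σ τ)) p)) =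
  ∈-concatMap⁺ (λ p → joins m (perms f (proj₁ p)) (perms f (proj₂ p)))
    (lose XY∈ (∈-joins⁺ (perms-complete f X (≤-trans (length-splitsˡ {L = L} XY∈) L≤f) σ↭X)
                        (perms-complete f Y (≤-trans (length-splitsʳ {L = L} XY∈) L≤f) τ↭Y)))

perms-unique : ∀ f L → Increasing L → Unique (perms f L)
perms-unique f       []      _           = [] ∷ []
perms-unique zero    (_ ∷ _) _           = []
perms-unique (suc f) (m ∷ L) (m<L ∷ incL) =
  concatMap-unique (splits-unique L (increasing⇒unique incL)) block-unique same-split
  where
  m∉ : ∀ {X Y σ} → (X , Y) ∈ splits L → σ ∈ perms f X → m ∉ σ
  m∉ {X} XY∈ σ∈ m∈σ = <-irrefl refl (All.lookup m<L (∈-splitsˡ XY∈ (∈-resp-↭ (perms-sound f X σ∈) m∈σ)))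
  block-unique : ∀ {p} → p ∈ splits L → Unique (joins m (perms f (proj₁ p)) (perms f (proj₂ p)))
  block-unique {X , Y} XY∈ = let incX , incY = splits-AllPairs L incL XY∈ in
    joins-unique (perms-unique f X incX) (perms-unique f Y incY) (m∉ XY∈)
  same-split : ∀ {p p′ w} → p ∈ splits L → p′ ∈ splits L →
               w ∈ joins m (perms f (proj₁ p)) (perms f (proj₂ p)) → w ∈ joins m (perms f (proj₁ p′)) (perms f (proj₂ p′)) → p ≡ p′
  same-split {X , Y} {X′ , Y′} XY∈ XY′∈ w∈ w∈′
    with σ , τ , σ∈ , τ∈ , refl ← ∈-joins⁻ {m} w∈ | σ′ , τ′ , σ′∈ , τ′∈ , eq ← ∈-joins⁻ {m} w∈′
    with refl , refl ← ++-∷-cancel σ σ′ (m∉ XY∈ σ∈) (m∉ XY′∈ σ′∈) eq =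
    let incX , incY = splits-AllPairs L incL XY∈ ; incX′ , incY′ = splits-AllPairs L incL XY′∈ in
    cong₂ _,_ (increasing-↭⇒≡ incX incX′ (↭-trans (↭-sym (perms-sound f X σ∈)) (perms-sound f X′ σ′∈)))
              (increasing-↭⇒≡ incY incY′ (↭-trans (↭-sym (perms-sound f Y τ∈)) (perms-sound f Y′ τ′∈)))

length-range : ∀ n → length (range n) ≡ n
length-range n = trans (length-map suc (upTo n)) (length-upTo n)

range-increasing : ∀ n → Increasing (range n)
range-increasing n = AllPairs.map⁺ (AllPairs.applyUpTo⁺₁ (λ i → i) n (λ i<j _ → s≤s i<j))

∈-words⁺ : ∀ {alph w : List ℕ} → All (_∈ alph) w → w ∈ words (length w) alph
∈-words⁺              []            = here refl
∈-words⁺ {alph} {a ∷ w} (a∈ ∷ w⊆) =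
  ∈-concatMap⁺ (λ a → map (a ∷_) (words (length w) alph)) (lose a∈ (∈-map⁺ (a ∷_) (∈-words⁺ w⊆)))

∈-words⁻ : ∀ m {alph w : List ℕ} → w ∈ words m alph → length w ≡ m × All (_∈ alph) w
∈-words⁻ zero    (here refl) = refl , []
∈-words⁻ (suc m) {alph} p
  with a , a∈ , q ← find (∈-concatMap⁻ (λ a → map (a ∷_) (words m alph)) {xs = alph} p)
  with w , w∈ , refl ← ∈-map⁻ (a ∷_) q
  = let |w| , w⊆ = ∈-words⁻ m w∈ in cong suc |w| , a∈ ∷ w⊆

words-unique : ∀ m {alph : List ℕ} → Unique alph → Unique (words m alph)
words-unique zero    _     = [] ∷ []
words-unique (suc m) {alph} uniq =
  concatMap-unique uniq (λ _ → Unique.map⁺ ∷-injectiveʳ (words-unique m uniq)) same-head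
  where
  same-head : ∀ {a a′ w} → a ∈ alph → a′ ∈ alph → w ∈ map (a ∷_) (words m alph) → w ∈ map (a′ ∷_) (words m alph) → a ≡ a′
  same-head _ _ p q with _ , _ , refl ← ∈-map⁻ _ p | _ , _ , eq ← ∈-map⁻ _ q = ∷-injectiveˡ eq

↭-of-covering : ∀ {A : Set} {R w : List A} → Unique R → All (_∈ w) R → length w ≡ length R → w ↭ R
↭-of-covering {R = []}    {w = []} _          _           _     = ↭-refl
↭-of-covering {R = r ∷ R} (r∉R ∷ uR) (r∈w ∷ R⊆w) |w|≡
  with w₁ , w₂ , refl ← ∈-∃++ r∈w =
  ↭-trans (shift r w₁ w₂) (prep r (↭-of-covering uR (All.tabulate R⊆w′) (suc-injective (trans (sym (↭-length (shift r w₁ w₂))) |w|≡))))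
  where
  R⊆w′ : ∀ {z} → z ∈ R → z ∈ w₁ ++ w₂
  R⊆w′ z∈R with ∈-resp-↭ (shift r w₁ w₂) (All.lookup R⊆w z∈R)
  ... | here refl = ⊥-elim (All.lookup r∉R z∈R refl)
  ... | there z∈w = z∈w

∈-S⁻ : ∀ n {w} → w ∈ S n → w ↭ range n
∈-S⁻ n p with w∈ , range⊆w ← ∈-filter⁻ (λ w → all? (λ i → i ∈? w) (range n)) {xs = words n (range n)} p =
  let |w| , _ = ∈-words⁻ n w∈ in
  ↭-of-covering (increasing⇒unique (range-increasing n)) range⊆w (trans |w| (sym (length-range n)))

∈-S⁺ : ∀ n {w} → w ↭ range n → w ∈ S n
∈-S⁺ n {w} w↭ = ∈-filter⁺ (λ w → all? (λ i → i ∈? w) (range n))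
  (subst (λ m → w ∈ words m (range n)) (trans (↭-length w↭) (length-range n)) (∈-words⁺ (All.tabulate (∈-resp-↭ w↭))))
  (All.tabulate (∈-resp-↭ (↭-sym w↭)))

S-unique : ∀ n → Unique (S n)
S-unique n = Unique.filter⁺ (λ w → all? (λ i → i ∈? w) (range n)) (words-unique n (increasing⇒unique (range-increasing n)))

S↭perms : ∀ {n f} → n ≤ f → S n ↭ perms f (range n)
S↭perms {n} {f} n≤f = ∼bag⇒↭ (unique∧set⇒bag (S-unique n) (perms-unique f (range n) (range-increasing n))
  (mk⇔ (perms-complete f (range n) (≤-trans (≤-reflexive (length-range n)) n≤f) ∘ ∈-S⁻ n) (∈-S⁺ n ∘ perms-sound f (range n))))

-- Occurrences of the segmented pattern

χ : {P : Set} → Dec P → ℕ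
χ (yes _) = 1
χ (no  _) = 0

χ-yes : ∀ {P : Set} (p? : Dec P) → P → χ p? ≡ 1
χ-yes (yes _) _ = refl
χ-yes (no ¬p) p = ⊥-elim (¬p p)

χ-no : ∀ {P : Set} (p? : Dec P) → ¬ P → χ p? ≡ 0
χ-no (yes p) ¬p = ⊥-elim (¬p p)
χ-no (no  _) _  = refl

χ-cong : ∀ {P Q : Set} → P ⇔ Q → (p? : Dec P) (q? : Dec Q) → χ p? ≡ χ q?
χ-cong P⇔Q p?      (yes q) = χ-yes p? (Equivalence.from P⇔Q q)
χ-cong P⇔Q p?      (no ¬q) = χ-no p? (¬q ∘ Equivalence.to P⇔Q)

take-++ : ∀ {A : Set} n (xs ys : List A) → n ≤ length xs → take n (xs ++ ys) ≡ take n xs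
take-++ zero    xs       ys _         = refl
take-++ (suc n) (x ∷ xs) ys (s≤s n≤xs) = cong (x ∷_) (take-++ n xs ys n≤xs)

∈-take-++-∷ : ∀ {A : Set} n (xs : List A) {y ys} → length xs < n → y ∈ take n (xs ++ y ∷ ys)
∈-take-++-∷ (suc n) []       _           = here refl
∈-take-++-∷ (suc n) (x ∷ xs) (s≤s xs<n) = there (∈-take-++-∷ n xs xs<n)

module Occurrences (k : ℕ) where

  open import Data.Nat.Base using (_+_)
  open import Data.Nat.Properties using (+-assoc)

  StartsOcc : ℕ → List ℕ → Set
  StartsOcc a r = k ≤ length r × All (a <_) (take k r)

  startsOcc? : ∀ a r → Dec (StartsOcc a r)
  startsOcc? a r = k ≤? length r ×-dec all? (a <?_) (take k r)

  occ-∷ : ∀ a r → occ k (a ∷ r) ≡ χ (startsOcc? a r) + occ k r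
  occ-∷ a r with startsOcc? a r
  ... | yes _ = refl
  ... | no  _ = refl

  startsOcc-++-∷ : ∀ {a m} σ τ → m < a → StartsOcc a (σ ++ m ∷ τ) ⇔ StartsOcc a σ
  startsOcc-++-∷ {a} {m} σ τ m<a = mk⇔ to from
    where
    to : StartsOcc a (σ ++ m ∷ τ) → StartsOcc a σ
    to (_ , a<window) with k ≤? length σ
    ... | yes k≤σ = k≤σ , subst (All (a <_)) (take-++ k σ (m ∷ τ) k≤σ) a<window
    ... | no  k≰σ = ⊥-elim (<-asym m<a (All.lookup a<window (∈-take-++-∷ k σ (≰⇒> k≰σ))))
    from : StartsOcc a σ → StartsOcc a (σ ++ m ∷ τ)
    from (k≤σ , a<window) = ≤-trans k≤σ (length-++-≤ˡ σ) , subst (All (a <_)) (sym (take-++ k σ (m ∷ τ) k≤σ)) a<window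

  occ-++-∷ : ∀ {m} σ τ → All (m <_) σ → occ k (σ ++ m ∷ τ) ≡ occ k σ + occ k (m ∷ τ)
  occ-++-∷         []      τ _             = refl
  occ-++-∷ {m} (a ∷ σ) τ (m<a ∷ m<σ) = begin
    occ k (a ∷ σ ++ m ∷ τ)                                         ≡⟨ occ-∷ a (σ ++ m ∷ τ) ⟩
    χ (startsOcc? a (σ ++ m ∷ τ)) + occ k (σ ++ m ∷ τ)             ≡⟨ cong₂ _+_ (χ-cong (startsOcc-++-∷ σ τ m<a) (startsOcc? a (σ ++ m ∷ τ)) (startsOcc? a σ))
                                                                               (occ-++-∷ σ τ m<σ) ⟩
    χ (startsOcc? a σ) + (occ k σ + occ k (m ∷ τ))                 ≡⟨ +-assoc (χ (startsOcc? a σ)) (occ k σ) _ ⟨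
    χ (startsOcc? a σ) + occ k σ + occ k (m ∷ τ)                   ≡⟨ cong (_+ occ k (m ∷ τ)) (occ-∷ a σ) ⟨
    occ k (a ∷ σ) + occ k (m ∷ τ)                                  ∎
    where open ≡-Reasoning

  occ-∷-min : ∀ {m} τ → All (m <_) τ → occ k (m ∷ τ) ≡ χ (k ≤? length τ) + occ k τ
  occ-∷-min {m} τ m<τ =
    trans (occ-∷ m τ) (cong (_+ occ k τ) (χ-cong (mk⇔ proj₁ (λ k≤τ → k≤τ , All.take⁺ k m<τ)) _ _))

  occ-short : ∀ w → length w ≤ k → occ k w ≡ 0
  occ-short []      _     = refl
  occ-short (a ∷ r) r<k = trans (occ-∷ a r)
    (cong₂ _+_ (χ-no (startsOcc? a r) (<⇒≱ r<k ∘ proj₁)) (occ-short r (≤-trans (n≤1+n _) r<k)))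

-- Counting permutations by their number of occurrences

module NatSums where

  open import Data.Nat.Base using (_+_; _*_)
  open import Data.Nat.Properties
    using (+-identityʳ; +-assoc; +-comm; *-identityˡ; *-zeroʳ; *-distribʳ-+; *-distribˡ-+; +-∸-assoc; _!*_!≢0;
           +-*-commutativeSemiring)
  open import Data.Nat.Combinatorics using (k>n⇒nCk≡0; nCk+nC[k+1]≡[n+1]C[k+1]; nCk≡n!/k![n-k]!; k![n∸k]!∣n!)
  open import Data.Nat.DivMod using (m/n*n≡m)
  open import Data.Nat.ListAction using (sum)
  open import Data.Nat.ListAction.Properties using (sum-++; sum-↭)
  open import Data.List.Base using (filter)
  open import Data.List.Properties using (map-++; map-∘; map-cong-local; filter-accept; filter-reject)
  import Data.List.Relation.Binary.Permutation.Propositional.Properties as ↭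

  open RangeSum +-*-commutativeSemiring public

  ∑<-const : ∀ n c → ∑< n (λ _ → c) ≡ n * c
  ∑<-const zero    c = refl
  ∑<-const (suc n) c = cong (c +_) (∑<-const n c)

  δ : ℕ → ℕ → ℕ
  δ zero    zero    = 1
  δ zero    (suc _) = 0
  δ (suc _) zero    = 0
  δ (suc m) (suc n) = δ m n

  δ-refl : ∀ m → δ m m ≡ 1
  δ-refl zero    = refl
  δ-refl (suc m) = δ-refl m

  δ-≢ : ∀ {m n} → m ≢ n → δ m n ≡ 0
  δ-≢ {zero}  {zero}  m≢n = ⊥-elim (m≢n refl)
  δ-≢ {zero}  {suc n} m≢n = refl
  δ-≢ {suc m} {zero}  m≢n = refl
  δ-≢ {suc m} {suc n} m≢n = δ-≢ (m≢n ∘ cong suc)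

  δ-+ : ∀ m n j → δ (m + n) j ≡ ∑< (suc j) (λ b → δ m b * δ n (j ∸ b))
  δ-+ zero    n j       = sym (begin
    (δ n j + 0) + ∑< j (λ _ → 0) ≡⟨ cong₂ _+_ (+-identityʳ (δ n j)) (∑<-zero j (λ _ _ → refl)) ⟩
    δ n j + 0                    ≡⟨ +-identityʳ (δ n j) ⟩
    δ n j                        ∎)
    where open ≡-Reasoning
  δ-+ (suc m) n zero    = refl
  δ-+ (suc m) n (suc j) = δ-+ m n j

  ∑∈ : {A : Set} → (A → ℕ) → List A → ℕ
  ∑∈ g xs = sum (map g xs)

  module _ {A : Set} where

    ∑∈-++ : ∀ (g : A → ℕ) (xs ys : List A) → ∑∈ g (xs ++ ys) ≡ ∑∈ g xs + ∑∈ g ys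
    ∑∈-++ g xs ys = trans (cong sum (map-++ g xs ys)) (sum-++ (map g xs) (map g ys))

    ∑∈-map : ∀ {B : Set} (g : A → ℕ) (f : B → A) xs → ∑∈ g (map f xs) ≡ ∑∈ (g ∘ f) xs
    ∑∈-map g f xs = cong sum (sym (map-∘ xs))

    ∑∈-concatMap : ∀ {B : Set} (g : A → ℕ) (f : B → List A) xs → ∑∈ g (concatMap f xs) ≡ ∑∈ (∑∈ g ∘ f) xs
    ∑∈-concatMap g f []       = refl
    ∑∈-concatMap g f (x ∷ xs) = trans (∑∈-++ g (f x) (concatMap f xs)) (cong (∑∈ g (f x) +_) (∑∈-concatMap g f xs))

    ∑∈-cong : ∀ {g h : A → ℕ} xs → (∀ {x} → x ∈ xs → g x ≡ h x) → ∑∈ g xs ≡ ∑∈ h xs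
    ∑∈-cong xs g≡h = cong sum (map-cong-local (All.tabulate g≡h))

    ∑∈-↭ : ∀ (g : A → ℕ) {xs ys} → xs ↭ ys → ∑∈ g xs ≡ ∑∈ g ys
    ∑∈-↭ g xs↭ys = sum-↭ (↭.map⁺ g xs↭ys)

    ∑∈-zero : ∀ (xs : List A) → ∑∈ (λ _ → 0) xs ≡ 0
    ∑∈-zero []       = refl
    ∑∈-zero (x ∷ xs) = ∑∈-zero xs

    *-distribʳ-∑∈ : ∀ (g : A → ℕ) xs c → ∑∈ g xs * c ≡ ∑∈ (λ x → g x * c) xs
    *-distribʳ-∑∈ g []       c = refl
    *-distribʳ-∑∈ g (x ∷ xs) c = trans (*-distribʳ-+ c (g x) (∑∈ g xs)) (cong (g x * c +_) (*-distribʳ-∑∈ g xs c))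

    *-distribˡ-∑∈ : ∀ (g : A → ℕ) xs c → c * ∑∈ g xs ≡ ∑∈ (λ x → c * g x) xs
    *-distribˡ-∑∈ g []       c = *-zeroʳ c
    *-distribˡ-∑∈ g (x ∷ xs) c = trans (*-distribˡ-+ c (g x) (∑∈ g xs)) (cong (c * g x +_) (*-distribˡ-∑∈ g xs c))

    ∑∈-∑<-comm : ∀ n (F : A → ℕ → ℕ) xs → ∑∈ (λ x → ∑< n (F x)) xs ≡ ∑< n (λ b → ∑∈ (λ x → F x b) xs)
    ∑∈-∑<-comm n F []       = sym (∑<-zero n (λ _ _ → refl))
    ∑∈-∑<-comm n F (x ∷ xs) = trans (cong (∑< n (F x) +_) (∑∈-∑<-comm n F xs))
                                    (sym (∑<-distrib-+ n (F x) (λ b → ∑∈ (λ x → F x b) xs)))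

    length-filter-≟ : ∀ (e : A → ℕ) j xs → length (filter (λ x → e x ≟ j) xs) ≡ ∑∈ (λ x → δ (e x) j) xs
    length-filter-≟ e j []       = refl
    length-filter-≟ e j (x ∷ xs) with e x ≟ j
    ... | yes ex≡j = begin
      length (filter (λ x → e x ≟ j) (x ∷ xs)) ≡⟨ cong length (filter-accept (λ x → e x ≟ j) ex≡j) ⟩
      suc (length (filter (λ x → e x ≟ j) xs)) ≡⟨ cong suc (length-filter-≟ e j xs) ⟩
      1 + ∑∈ (λ x → δ (e x) j) xs              ≡⟨ cong (_+ ∑∈ (λ x → δ (e x) j) xs) (trans (sym (δ-refl j)) (cong (λ i → δ i j) (sym ex≡j))) ⟩
      δ (e x) j + ∑∈ (λ x → δ (e x) j) xs      ∎
      where open ≡-Reasoning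
    ... | no ex≢j = begin
      length (filter (λ x → e x ≟ j) (x ∷ xs)) ≡⟨ cong length (filter-reject (λ x → e x ≟ j) ex≢j) ⟩
      length (filter (λ x → e x ≟ j) xs)       ≡⟨ length-filter-≟ e j xs ⟩
      ∑∈ (λ x → δ (e x) j) xs                  ≡⟨ cong (_+ ∑∈ (λ x → δ (e x) j) xs) (sym (δ-≢ ex≢j)) ⟩
      δ (e x) j + ∑∈ (λ x → δ (e x) j) xs      ∎
      where open ≡-Reasoning

  binomialSum : ℕ → (ℕ → ℕ → ℕ) → ℕ
  binomialSum n H = ∑< (suc n) (λ a → (n C a) * H (n ∸ a) a)

  binomialSum-suc : ∀ n H → binomialSum (suc n) H ≡ binomialSum n (λ x y → H (suc x) y) + binomialSum n (λ x y → H x (suc y))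
  binomialSum-suc n H = begin
    1 * H (suc n) 0 + ∑< (suc n) (λ a → (suc n C suc a) * H (n ∸ a) (suc a))
      ≡⟨ cong₂ _+_ (*-identityˡ (H (suc n) 0)) (∑<-cong (suc n) (λ a _ → pascal a)) ⟩
    H (suc n) 0 + ∑< (suc n) (λ a → (n C a) * H (n ∸ a) (suc a) + (n C suc a) * H (n ∸ a) (suc a))
      ≡⟨ cong (H (suc n) 0 +_) (∑<-distrib-+ (suc n) (λ a → (n C a) * H (n ∸ a) (suc a)) (λ a → (n C suc a) * H (n ∸ a) (suc a))) ⟩
    H (suc n) 0 + (binomialSum n (λ x y → H x (suc y)) + above)
      ≡⟨ cong (H (suc n) 0 +_) (+-comm _ above) ⟩
    H (suc n) 0 + (above + binomialSum n (λ x y → H x (suc y)))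
      ≡⟨ +-assoc (H (suc n) 0) above _ ⟨
    H (suc n) 0 + above + binomialSum n (λ x y → H x (suc y))
      ≡⟨ cong (λ t → t + binomialSum n (λ x y → H x (suc y))) first ⟨
    binomialSum n (λ x y → H (suc x) y) + binomialSum n (λ x y → H x (suc y)) ∎
    where
    open ≡-Reasoning
    above : ℕ
    above = ∑< (suc n) (λ a → (n C suc a) * H (n ∸ a) (suc a))
    pascal : ∀ a → (suc n C suc a) * H (n ∸ a) (suc a) ≡ (n C a) * H (n ∸ a) (suc a) + (n C suc a) * H (n ∸ a) (suc a)
    pascal a = trans (cong (_* H (n ∸ a) (suc a)) (sym (nCk+nC[k+1]≡[n+1]C[k+1] n a))) (*-distribʳ-+ (H (n ∸ a) (suc a)) (n C a) (n C suc a))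
    first : binomialSum n (λ x y → H (suc x) y) ≡ H (suc n) 0 + above
    first = begin
      1 * H (suc n) 0 + ∑< n (λ a → (n C suc a) * H (suc (n ∸ suc a)) (suc a))
        ≡⟨ cong₂ _+_ (*-identityˡ (H (suc n) 0)) (∑<-cong n (λ a a<n → cong (λ x → (n C suc a) * H x (suc a)) (sym (+-∸-assoc 1 a<n)))) ⟩
      H (suc n) 0 + ∑< n (λ a → (n C suc a) * H (n ∸ a) (suc a))
        ≡⟨ cong (H (suc n) 0 +_) (+-identityʳ _) ⟨
      H (suc n) 0 + (∑< n (λ a → (n C suc a) * H (n ∸ a) (suc a)) + 0)
        ≡⟨ cong (λ t → H (suc n) 0 + (∑< n (λ a → (n C suc a) * H (n ∸ a) (suc a)) + t * H (n ∸ n) (suc n)))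
                (k>n⇒nCk≡0 (n<1+n n)) ⟨
      H (suc n) 0 + (∑< n (λ a → (n C suc a) * H (n ∸ a) (suc a)) + (n C suc n) * H (n ∸ n) (suc n))
        ≡⟨ cong (H (suc n) 0 +_) (∑<-init-last n (λ a → (n C suc a) * H (n ∸ a) (suc a))) ⟨
      H (suc n) 0 + above ∎

  ∑∈-splits : ∀ {A : Set} (L : List A) H →
              ∑∈ (λ p → H (length (proj₁ p)) (length (proj₂ p))) (splits L) ≡ binomialSum (length L) H
  ∑∈-splits []      H = cong (_+ 0) (sym (*-identityˡ (H 0 0)))
  ∑∈-splits {A} (x ∷ L) H = begin
    ∑∈ G (map (map₁ (x ∷_)) (splits L) ++ map (map₂ (x ∷_)) (splits L))
      ≡⟨ ∑∈-++ G (map (map₁ (x ∷_)) (splits L)) _ ⟩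
    ∑∈ G (map (map₁ (x ∷_)) (splits L)) + ∑∈ G (map (map₂ (x ∷_)) (splits L))
      ≡⟨ cong₂ _+_ (∑∈-map G _ (splits L)) (∑∈-map G _ (splits L)) ⟩
    ∑∈ (λ p → H (suc (length (proj₁ p))) (length (proj₂ p))) (splits L) + ∑∈ (λ p → H (length (proj₁ p)) (suc (length (proj₂ p)))) (splits L)
      ≡⟨ cong₂ _+_ (∑∈-splits L (λ u v → H (suc u) v)) (∑∈-splits L (λ u v → H u (suc v))) ⟩
    binomialSum (length L) (λ u v → H (suc u) v) + binomialSum (length L) (λ u v → H u (suc v))
      ≡⟨ binomialSum-suc (length L) H ⟨
    binomialSum (suc (length L)) H ∎
    where
    open ≡-Reasoning
    G : List A × List A → ℕ
    G p = H (length (proj₁ p)) (length (proj₂ p))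

  binomial-factorials : ∀ {n a} → a ≤ n → (n C a) * (a ! * (n ∸ a) !) ≡ n !
  binomial-factorials {n} {a} a≤n =
    trans (cong (_* (a ! * (n ∸ a) !)) (nCk≡n!/k![n-k]! a≤n)) (m/n*n≡m {{a !* (n ∸ a) !≢0}} (k![n∸k]!∣n! a≤n))

module Counting (k : ℕ) where

  open import Data.Nat.Base using (_+_; _*_)
  open import Data.Nat.Properties using (+-identityʳ)
  open import Data.Nat.Induction using (<-rec)
  open import Data.Nat.Solver using (module +-*-Solver)
  open +-*-Solver using (solve; _:+_; _:=_)
  open Occurrences k
  open NatSums

  -- The shift d accounts for an occurrence lying outside the words of W.
  occCount : ℕ → ℕ → List (List ℕ) → ℕ
  occCount d j = ∑∈ (λ w → δ (d + occ k w) j)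

  occCount-↭ : ∀ d j {W W′} → W ↭ W′ → occCount d j W ≡ occCount d j W′
  occCount-↭ d j = ∑∈-↭ (λ w → δ (d + occ k w) j)

  occCount-shift : ∀ V j W → occCount V j W ≡ ∑< (suc j) (λ b → δ V b * occCount 0 (j ∸ b) W)
  occCount-shift V j W = begin
    ∑∈ (λ w → δ (V + occ k w) j) W
      ≡⟨ ∑∈-cong W (λ {w} _ → δ-+ V (occ k w) j) ⟩
    ∑∈ (λ w → ∑< (suc j) (λ b → δ V b * δ (occ k w) (j ∸ b))) W
      ≡⟨ ∑∈-∑<-comm (suc j) (λ w b → δ V b * δ (occ k w) (j ∸ b)) W ⟩
    ∑< (suc j) (λ b → ∑∈ (λ w → δ V b * δ (occ k w) (j ∸ b)) W)
      ≡⟨ ∑<-cong (suc j) (λ b _ → sym (*-distribˡ-∑∈ (λ w → δ (occ k w) (j ∸ b)) W (δ V b))) ⟩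
    ∑< (suc j) (λ b → δ V b * occCount 0 (j ∸ b) W) ∎
    where open ≡-Reasoning

  occCount-joins : ∀ {m l Σs Τs} d j → (∀ {σ} → σ ∈ Σs → All (m <_) σ) → (∀ {τ} → τ ∈ Τs → All (m <_) τ × length τ ≡ l) →
    occCount d j (joins m Σs Τs) ≡ ∑< (suc j) (λ b → occCount (d + χ (k ≤? l)) b Τs * occCount 0 (j ∸ b) Σs)
  occCount-joins {m} {l} {Σs} {Τs} d j m<Σ m<Τ = begin
    occCount d j (joins m Σs Τs)
      ≡⟨ ∑∈-concatMap (λ w → δ (d + occ k w) j) (λ τ → map (λ σ → σ ++ m ∷ τ) Σs) Τs ⟩
    ∑∈ (λ τ → ∑∈ (λ w → δ (d + occ k w) j) (map (λ σ → σ ++ m ∷ τ) Σs)) Τs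
      ≡⟨ ∑∈-cong Τs (λ τ∈ → trans (∑∈-map (λ w → δ (d + occ k w) j) _ Σs)
                                  (∑∈-cong Σs (λ σ∈ → cong (λ x → δ x j) (occ-join τ∈ σ∈)))) ⟩
    ∑∈ (λ τ → occCount (V τ) j Σs) Τs
      ≡⟨ ∑∈-cong Τs (λ {τ} _ → occCount-shift (V τ) j Σs) ⟩
    ∑∈ (λ τ → ∑< (suc j) (λ b → δ (V τ) b * occCount 0 (j ∸ b) Σs)) Τs
      ≡⟨ ∑∈-∑<-comm (suc j) (λ τ b → δ (V τ) b * occCount 0 (j ∸ b) Σs) Τs ⟩
    ∑< (suc j) (λ b → ∑∈ (λ τ → δ (V τ) b * occCount 0 (j ∸ b) Σs) Τs)
      ≡⟨ ∑<-cong (suc j) (λ b _ → sym (*-distribʳ-∑∈ (λ τ → δ (V τ) b) Τs (occCount 0 (j ∸ b) Σs))) ⟩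
    ∑< (suc j) (λ b → occCount (d + χ (k ≤? l)) b Τs * occCount 0 (j ∸ b) Σs) ∎
    where
    open ≡-Reasoning
    V : List ℕ → ℕ
    V τ = d + χ (k ≤? l) + occ k τ
    occ-join : ∀ {τ σ} → τ ∈ Τs → σ ∈ Σs → d + occ k (σ ++ m ∷ τ) ≡ V τ + occ k σ
    occ-join {τ} {σ} τ∈ σ∈ = let m<τ , |τ|≡l = m<Τ τ∈ in begin
      d + occ k (σ ++ m ∷ τ)                         ≡⟨ cong (d +_) (occ-++-∷ σ τ (m<Σ σ∈)) ⟩
      d + (occ k σ + occ k (m ∷ τ))                  ≡⟨ cong (λ x → d + (occ k σ + x)) (occ-∷-min τ m<τ) ⟩
      d + (occ k σ + (χ (k ≤? length τ) + occ k τ))  ≡⟨ cong (λ x → d + (occ k σ + (χ (k ≤? x) + occ k τ))) |τ|≡l ⟩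
      d + (occ k σ + (χ (k ≤? l) + occ k τ))         ≡⟨ solve 4 (λ d s c t → d :+ (s :+ (c :+ t)) := d :+ c :+ t :+ s) refl
                                                                d (occ k σ) (χ (k ≤? l)) (occ k τ) ⟩
      V τ + occ k σ                                  ∎

  minDecomposition : (ℕ → ℕ → ℕ → ℕ) → ℕ → ℕ → ℕ → ℕ
  minDecomposition κ d j n = binomialSum n (λ x y → ∑< (suc j) (λ b → κ (d + χ (k ≤? y)) b y * κ 0 (j ∸ b) x))

  -- κ computes the counts of lists within the fuel; it is first the counts on range a (to show that
  -- counts depend only on the length) and then the counts on S a.
  module _ (f : ℕ) (κ : ℕ → ℕ → ℕ → ℕ)
           (canonical : ∀ {Z} → Increasing Z → length Z ≤ f → ∀ d b → occCount d b (perms f Z) ≡ κ d b (length Z)) where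

    occCount-perms-∷ : ∀ {m L} → Increasing (m ∷ L) → length L ≤ f → ∀ d j →
                       occCount d j (perms (suc f) (m ∷ L)) ≡ minDecomposition κ d j (length L)
    occCount-perms-∷ {m} {L} (m<L ∷ incL) L≤f d j = begin
      occCount d j (perms (suc f) (m ∷ L))
        ≡⟨ ∑∈-concatMap (λ w → δ (d + occ k w) j) (λ p → joins m (perms f (proj₁ p)) (perms f (proj₂ p))) (splits L) ⟩
      ∑∈ (λ p → occCount d j (joins m (perms f (proj₁ p)) (perms f (proj₂ p)))) (splits L)
        ≡⟨ ∑∈-cong (splits L) block ⟩
      ∑∈ (λ p → H (length (proj₁ p)) (length (proj₂ p))) (splits L)
        ≡⟨ ∑∈-splits L H ⟩
      minDecomposition κ d j (length L) ∎
      where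
      open ≡-Reasoning
      H : ℕ → ℕ → ℕ
      H x y = ∑< (suc j) (λ b → κ (d + χ (k ≤? y)) b y * κ 0 (j ∸ b) x)
      m<perms : ∀ {Z σ} → (∀ {z} → z ∈ Z → z ∈ L) → σ ∈ perms f Z → All (m <_) σ
      m<perms {Z} Z⊆L σ∈ = All.tabulate (λ z∈σ → All.lookup m<L (Z⊆L (∈-resp-↭ (perms-sound f Z σ∈) z∈σ)))
      block : ∀ {p} → p ∈ splits L → occCount d j (joins m (perms f (proj₁ p)) (perms f (proj₂ p))) ≡ H (length (proj₁ p)) (length (proj₂ p))
      block {X , Y} XY∈ = let incX , incY = splits-AllPairs L incL XY∈ in begin
        occCount d j (joins m (perms f X) (perms f Y))
          ≡⟨ occCount-joins d j (m<perms (∈-splitsˡ {L = L} XY∈))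
                                (λ τ∈ → m<perms (∈-splitsʳ {L = L} XY∈) τ∈ , ↭-length (perms-sound f Y τ∈)) ⟩
        ∑< (suc j) (λ b → occCount (d + χ (k ≤? length Y)) b (perms f Y) * occCount 0 (j ∸ b) (perms f X))
          ≡⟨ ∑<-cong (suc j) (λ b _ → cong₂ _*_ (canonical incY (≤-trans (length-splitsʳ {L = L} XY∈) L≤f) (d + χ (k ≤? length Y)) b)
                                               (canonical incX (≤-trans (length-splitsˡ {L = L} XY∈) L≤f) 0 (j ∸ b))) ⟩
        H (length X) (length Y) ∎

  occCount-perms-length : ∀ f {X X′} → Increasing X → Increasing X′ → length X ≡ length X′ → length X ≤ f →
                          ∀ d j → occCount d j (perms f X) ≡ occCount d j (perms f X′)
  occCount-perms-length f       {[]}    {[]}     _    _     _    _   d j = refl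
  occCount-perms-length f       {[]}    {_ ∷ _}  _    _     ()   _   d j
  occCount-perms-length f       {_ ∷ _} {[]}     _    _     ()   _   d j
  occCount-perms-length zero    {_ ∷ _} {_ ∷ _}  _    _     _    ()  d j
  occCount-perms-length (suc f) {m ∷ L} {m′ ∷ L′} incX incX′ |X|≡ (s≤s L≤f) d j = begin
    occCount d j (perms (suc f) (m ∷ L))   ≡⟨ occCount-perms-∷ f κ canonical incX L≤f d j ⟩
    minDecomposition κ d j (length L)       ≡⟨ cong (minDecomposition κ d j) |L|≡ ⟩
    minDecomposition κ d j (length L′)      ≡⟨ occCount-perms-∷ f κ canonical incX′ (subst (_≤ f) |L|≡ L≤f) d j ⟨
    occCount d j (perms (suc f) (m′ ∷ L′)) ∎
    where
    open ≡-Reasoning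
    |L|≡ : length L ≡ length L′
    |L|≡ = suc-injective |X|≡
    κ : ℕ → ℕ → ℕ → ℕ
    κ d b n = occCount d b (perms f (range n))
    canonical : ∀ {Z} → Increasing Z → length Z ≤ f → ∀ d b → occCount d b (perms f Z) ≡ κ d b (length Z)
    canonical {Z} incZ Z≤f = occCount-perms-length f incZ (range-increasing (length Z)) (sym (length-range (length Z))) Z≤f

  occCount-perms : ∀ {f X} → Increasing X → length X ≤ f → ∀ d j → occCount d j (perms f X) ≡ occCount d j (S (length X))
  occCount-perms {f} {X} incX X≤f d j =
    trans (occCount-perms-length f incX (range-increasing (length X)) (sym (length-range (length X))) X≤f d j)
          (sym (occCount-↭ d j (S↭perms X≤f)))

  occCount-S-suc : ∀ n j → occCount 0 j (S (suc n)) ≡ minDecomposition (λ d b m → occCount d b (S m)) 0 j n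
  occCount-S-suc n j = begin
    occCount 0 j (S (suc n))
      ≡⟨ occCount-↭ 0 j (S↭perms {suc n} ≤-refl) ⟩
    occCount 0 j (perms (suc n) (range (suc n)))
      ≡⟨ occCount-perms-∷ n κ occCount-perms (range-increasing (suc n)) (≤-reflexive |tail|≡n) 0 j ⟩
    minDecomposition κ 0 j (length (map suc (applyUpTo suc n)))
      ≡⟨ cong (minDecomposition κ 0 j) |tail|≡n ⟩
    minDecomposition κ 0 j n ∎
    where
    open ≡-Reasoning
    κ : ℕ → ℕ → ℕ → ℕ
    κ d b m = occCount d b (S m)
    |tail|≡n : length (map suc (applyUpTo suc n)) ≡ n
    |tail|≡n = suc-injective (length-range (suc n))

  occCount-S-short-suc : ∀ {m} i → m ≤ k → occCount 0 (suc i) (S m) ≡ 0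
  occCount-S-short-suc {m} i m≤k = trans (∑∈-cong (S m) no-occ) (∑∈-zero (S m))
    where
    no-occ : ∀ {w} → w ∈ S m → δ (occ k w) (suc i) ≡ 0
    no-occ {w} w∈ = cong (λ x → δ x (suc i))
      (occ-short w (≤-trans (≤-reflexive (trans (↭-length (∈-S⁻ m w∈)) (length-range m))) m≤k))

  occCount-S-short-zero : ∀ m → m < k → occCount 0 0 (S m) ≡ m !
  occCount-S-short-zero = <-rec (λ m → m < k → occCount 0 0 (S m) ≡ m !) step
    where
    step : ∀ m → (∀ {a} → a < m → a < k → occCount 0 0 (S a) ≡ a !) → m < k → occCount 0 0 (S m) ≡ m !
    step zero    _  _   = refl
    step (suc n) IH n<k = begin
      occCount 0 0 (S (suc n))                                    ≡⟨ occCount-S-suc n 0 ⟩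
      minDecomposition (λ d b m → occCount d b (S m)) 0 0 n        ≡⟨ ∑<-cong (suc n) term ⟩
      ∑< (suc n) (λ _ → n !)                                      ≡⟨ ∑<-const (suc n) (n !) ⟩
      suc n * n !                                                 ∎
      where
      open ≡-Reasoning
      term : ∀ a → a < suc n → (n C a) * (occCount (χ (k ≤? a)) 0 (S a) * occCount 0 0 (S (n ∸ a)) + 0) ≡ n !
      term a (s≤s a≤n) = begin
        (n C a) * (occCount (χ (k ≤? a)) 0 (S a) * occCount 0 0 (S (n ∸ a)) + 0)
          ≡⟨ cong ((n C a) *_) (+-identityʳ _) ⟩
        (n C a) * (occCount (χ (k ≤? a)) 0 (S a) * occCount 0 0 (S (n ∸ a)))
          ≡⟨ cong (λ d → (n C a) * (occCount d 0 (S a) * occCount 0 0 (S (n ∸ a)))) (χ-no (k ≤? a) (<⇒≱ a<k)) ⟩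
        (n C a) * (occCount 0 0 (S a) * occCount 0 0 (S (n ∸ a)))
          ≡⟨ cong₂ (λ x y → (n C a) * (x * y)) (IH (s≤s a≤n) a<k) (IH (s≤s (m∸n≤m n a)) (≤-<-trans (m∸n≤m n a) n<k′)) ⟩
        (n C a) * (a ! * (n ∸ a) !)
          ≡⟨ binomial-factorials a≤n ⟩
        n ! ∎
        where
        n<k′ : n < k
        n<k′ = <-trans (n<1+n n) n<k
        a<k : a < k
        a<k = ≤-<-trans a≤n n<k′

-- Exponential generating functions

import Data.Integer.Base as ℤ
import Data.Integer.Properties as ℤ
open import Data.Rational.Base using (ℚ; 0ℚ; 1ℚ; _/_; _+_; _*_; _-_; -_)
open import Data.Rational.Properties
  using (toℚᵘ-injective; toℚᵘ-fromℚᵘ; toℚᵘ-homo-+; toℚᵘ-homo-*; fromℚᵘ-cong; +-*-commutativeRing;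
         *-zeroˡ; +-identityˡ; +-identityʳ; +-inverseʳ; *-distribʳ-+)
import Data.Rational.Unnormalised.Base as ℚᵘ
import Data.Rational.Unnormalised.Properties as ℚᵘ
open import Data.Rational.Solver using (module +-*-Solver)
open NatSums using (binomialSum; binomial-factorials; length-filter-≟; ∑∈-zero)

open RangeSum (CommutativeRing.commutativeSemiring +-*-commutativeRing)
open +-*-Solver using (solve; _:+_; _:*_; _:-_; _:=_; con)

ι : ℕ → ℚ
ι n = ℤ.+ n / 1

1/! : ℕ → ℚ
1/! n = (ℤ.+ 1 / n !) {{n ℕ.!≢0}}

/-cross : ∀ a b d e .{{_ : NonZero d}} .{{_ : NonZero e}} → a ℕ.* e ≡ b ℕ.* d → ℤ.+ a / d ≡ ℤ.+ b / e
/-cross a b (suc d) (suc e) eq =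
  fromℚᵘ-cong {ℚᵘ.mkℚᵘ (ℤ.+ a) d} {ℚᵘ.mkℚᵘ (ℤ.+ b) e}
    (ℚᵘ.*≡* (trans (sym (ℤ.pos-* a (suc e))) (trans (cong ℤ.+_ eq) (ℤ.pos-* b (suc d)))))

/-*-/ : ∀ a b d e .{{_ : NonZero d}} .{{_ : NonZero e}} → (ℤ.+ a / d) * (ℤ.+ b / e) ≡ (ℤ.+ (a ℕ.* b) / (d ℕ.* e)) {{ℕ.m*n≢0 d e}}
/-*-/ a b (suc d) (suc e) = toℚᵘ-injective (ℚᵘ.≃-trans (toℚᵘ-homo-* (ℤ.+ a / suc d) (ℤ.+ b / suc e))
  (ℚᵘ.≃-trans (ℚᵘ.*-cong (toℚᵘ-fromℚᵘ (ℚᵘ.mkℚᵘ (ℤ.+ a) d)) (toℚᵘ-fromℚᵘ (ℚᵘ.mkℚᵘ (ℤ.+ b) e)))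
  (ℚᵘ.≃-trans (ℚᵘ.≃-reflexive (cong (λ n → ℚᵘ.mkℚᵘ n (e ℕ.+ d ℕ.* suc e)) (sym (ℤ.pos-* a b))))
              (ℚᵘ.≃-sym (toℚᵘ-fromℚᵘ (ℚᵘ.mkℚᵘ (ℤ.+ (a ℕ.* b)) (e ℕ.+ d ℕ.* suc e)))))))

/-*-/≡/ : ∀ a b c d e f .{{_ : NonZero d}} .{{_ : NonZero e}} .{{_ : NonZero f}} →
          a ℕ.* b ℕ.* f ≡ c ℕ.* (d ℕ.* e) → (ℤ.+ a / d) * (ℤ.+ b / e) ≡ ℤ.+ c / f
/-*-/≡/ a b c d e f eq = trans (/-*-/ a b d e) (/-cross (a ℕ.* b) c (d ℕ.* e) f {{ℕ.m*n≢0 d e}} eq)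

ι-* : ∀ m n → ι (m ℕ.* n) ≡ ι m * ι n
ι-* m n = sym (/-*-/≡/ m n (m ℕ.* n) 1 1 1 refl)

ι-+ : ∀ m n → ι (m ℕ.+ n) ≡ ι m + ι n
ι-+ m n = sym (toℚᵘ-injective (ℚᵘ.≃-trans (toℚᵘ-homo-+ (ι m) (ι n))
  (ℚᵘ.≃-trans (ℚᵘ.+-cong (toℚᵘ-fromℚᵘ (ℚᵘ.mkℚᵘ (ℤ.+ m) 0)) (toℚᵘ-fromℚᵘ (ℚᵘ.mkℚᵘ (ℤ.+ n) 0)))
  (ℚᵘ.≃-trans (ℚᵘ.*≡* numerators) (ℚᵘ.≃-sym (toℚᵘ-fromℚᵘ (ℚᵘ.mkℚᵘ (ℤ.+ (m ℕ.+ n)) 0)))))))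
  where
  numerators : (ℤ.+ m ℤ.* ℤ.+ 1 ℤ.+ ℤ.+ n ℤ.* ℤ.+ 1) ℤ.* ℤ.+ 1 ≡ ℤ.+ (m ℕ.+ n) ℤ.* ℤ.+ 1
  numerators = trans (ℤ.*-identityʳ _) (trans (cong₂ ℤ._+_ (ℤ.*-identityʳ (ℤ.+ m)) (ℤ.*-identityʳ (ℤ.+ n)))
                     (trans (sym (ℤ.pos-+ m n)) (sym (ℤ.*-identityʳ _))))

ι-∑< : ∀ n f → ι (NatSums.∑< n f) ≡ ∑< n (λ i → ι (f i))
ι-∑< zero    f = refl
ι-∑< (suc n) f = trans (ι-+ (f 0) _) (cong (ι (f 0) +_) (ι-∑< n (λ i → f (suc i))))

/!≡ι*1/! : ∀ c n → (ℤ.+ c / n !) {{n ℕ.!≢0}} ≡ ι c * 1/! n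
/!≡ι*1/! c n = sym (/-*-/≡/ c 1 c 1 (n !) (n !) {{_}} {{n ℕ.!≢0}} {{n ℕ.!≢0}}
  (cong₂ ℕ._*_ (ℕ.*-identityʳ c) (sym (ℕ.*-identityˡ (n !)))))

ι-suc*1/!-suc : ∀ n → ι (suc n) * 1/! (suc n) ≡ 1/! n
ι-suc*1/!-suc n = /-*-/≡/ (suc n) 1 1 1 (suc n !) (n !) {{_}} {{suc n ℕ.!≢0}} {{n ℕ.!≢0}}
  (trans (cong (ℕ._* n !) (ℕ.*-identityʳ (suc n))) (sym (trans (ℕ.*-identityˡ _) (ℕ.*-identityˡ _))))

ι-!*1/! : ∀ n → ι (n !) * 1/! n ≡ 1ℚ
ι-!*1/! n = /-*-/≡/ (n !) 1 1 1 (n !) 1 {{_}} {{n ℕ.!≢0}}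
  (trans (ℕ.*-identityʳ _) (trans (ℕ.*-identityʳ _) (sym (trans (ℕ.*-identityˡ _) (ℕ.*-identityˡ _)))))

1/!-binomial : ∀ {n a} → (n C a) ℕ.* (a ! ℕ.* (n ∸ a) !) ≡ n ! → 1/! a * 1/! (n ∸ a) ≡ ι (n C a) * 1/! n
1/!-binomial {n} {a} C*!*!≡! =
  trans (/-*-/≡/ 1 1 (n C a) (a !) ((n ∸ a) !) (n !) {{a ℕ.!≢0}} {{(n ∸ a) ℕ.!≢0}} {{n ℕ.!≢0}}
                 (trans (ℕ.+-identityʳ (n !)) (sym C*!*!≡!)))
        (/!≡ι*1/! (n C a) n)

foldr-applyUpTo : ∀ m (g : ℕ → ℕ) (f : ℕ → ℚ) → foldr (λ i s → f i + s) 0ℚ (applyUpTo g m) ≡ ∑< m (f ∘ g)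
foldr-applyUpTo zero    g f = refl
foldr-applyUpTo (suc m) g f = cong (λ s → f (g 0) + s) (foldr-applyUpTo m (g ∘ suc) f)

Σ≤-∑< : ∀ n f → Σ≤ n f ≡ ∑< (suc n) f
Σ≤-∑< n f = foldr-applyUpTo (suc n) (λ i → i) f

⊛-∑< : ∀ A B n j → (A ⊛ B) n j ≡ ∑< (suc n) (λ a → ∑< (suc j) (λ b → A a b * B (n ∸ a) (j ∸ b)))
⊛-∑< A B n j = trans (Σ≤-∑< n (λ a → Σ≤ j (λ b → A a b * B (n ∸ a) (j ∸ b))))
  (∑<-cong (suc n) (λ a _ → Σ≤-∑< j (λ b → A a b * B (n ∸ a) (j ∸ b))))

⊛-congˡ : ∀ {A A′ : FPS₂} B → (∀ a b → A a b ≡ A′ a b) → ∀ n j → (A ⊛ B) n j ≡ (A′ ⊛ B) n j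
⊛-congˡ {A} {A′} B A≡A′ n j = begin
  (A ⊛ B) n j                                                          ≡⟨ ⊛-∑< A B n j ⟩
  ∑< (suc n) (λ a → ∑< (suc j) (λ b → A a b * B (n ∸ a) (j ∸ b)))      ≡⟨ ∑<-cong (suc n) (λ a _ → ∑<-cong (suc j) (λ b _ →
                                                                            cong (_* B (n ∸ a) (j ∸ b)) (A≡A′ a b))) ⟩
  ∑< (suc n) (λ a → ∑< (suc j) (λ b → A′ a b * B (n ∸ a) (j ∸ b)))     ≡⟨ ⊛-∑< A′ B n j ⟨
  (A′ ⊛ B) n j                                                         ∎
  where open ≡-Reasoning

⊛-distribʳ-⊕ : ∀ A B H n j → ((A ⊕ B) ⊛ H) n j ≡ (A ⊛ H) n j + (B ⊛ H) n j
⊛-distribʳ-⊕ A B H n j = begin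
  ((A ⊕ B) ⊛ H) n j
    ≡⟨ ⊛-∑< (A ⊕ B) H n j ⟩
  ∑< (suc n) (λ a → ∑< (suc j) (λ b → (A a b + B a b) * H (n ∸ a) (j ∸ b)))
    ≡⟨ ∑<-cong (suc n) (λ a _ → trans (∑<-cong (suc j) (λ b _ → *-distribʳ-+ (H (n ∸ a) (j ∸ b)) (A a b) (B a b)))
                                      (∑<-distrib-+ (suc j) (λ b → A a b * H (n ∸ a) (j ∸ b)) (λ b → B a b * H (n ∸ a) (j ∸ b)))) ⟩
  ∑< (suc n) (λ a → ∑< (suc j) (λ b → A a b * H (n ∸ a) (j ∸ b)) + ∑< (suc j) (λ b → B a b * H (n ∸ a) (j ∸ b)))
    ≡⟨ ∑<-distrib-+ (suc n) (λ a → ∑< (suc j) (λ b → A a b * H (n ∸ a) (j ∸ b))) (λ a → ∑< (suc j) (λ b → B a b * H (n ∸ a) (j ∸ b))) ⟩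
  ∑< (suc n) (λ a → ∑< (suc j) (λ b → A a b * H (n ∸ a) (j ∸ b))) + ∑< (suc n) (λ a → ∑< (suc j) (λ b → B a b * H (n ∸ a) (j ∸ b)))
    ≡⟨ cong₂ _+_ (⊛-∑< A H n j) (⊛-∑< B H n j) ⟨
  (A ⊛ H) n j + (B ⊛ H) n j ∎
  where open ≡-Reasoning

⊛-row₀ : ∀ A B → (∀ a b → A (suc a) b ≡ 0ℚ) → ∀ n j → (A ⊛ B) n j ≡ ∑< (suc j) (λ b → A 0 b * B n (j ∸ b))
⊛-row₀ A B A₊≡0 n j = begin
  (A ⊛ B) n j
    ≡⟨ ⊛-∑< A B n j ⟩
  ∑< (suc j) (λ b → A 0 b * B n (j ∸ b)) + ∑< n (λ a → ∑< (suc j) (λ b → A (suc a) b * B (n ∸ suc a) (j ∸ b)))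
    ≡⟨ cong (∑< (suc j) (λ b → A 0 b * B n (j ∸ b)) +_)
            (∑<-zero n (λ a _ → ∑<-zero (suc j) (λ b _ → trans (cong (_* B (n ∸ suc a) (j ∸ b)) (A₊≡0 a b)) (*-zeroˡ (B (n ∸ suc a) (j ∸ b)))))) ⟩
  ∑< (suc j) (λ b → A 0 b * B n (j ∸ b)) + 0ℚ
    ≡⟨ +-identityʳ (∑< (suc j) (λ b → A 0 b * B n (j ∸ b))) ⟩
  ∑< (suc j) (λ b → A 0 b * B n (j ∸ b)) ∎
  where open ≡-Reasoning

𝕪⊛-zero : ∀ B n → (𝕪 ⊛ B) n 0 ≡ 0ℚ
𝕪⊛-zero B n = trans (⊛-row₀ 𝕪 B (λ _ _ → refl) n 0) (solve 1 (λ x → con 0ℚ :* x :+ con 0ℚ := con 0ℚ) refl (B n 0))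

𝕪⊛-suc : ∀ B n j → (𝕪 ⊛ B) n (suc j) ≡ B n j
𝕪⊛-suc B n j = begin
  (𝕪 ⊛ B) n (suc j)
    ≡⟨ ⊛-row₀ 𝕪 B (λ _ _ → refl) n (suc j) ⟩
  0ℚ * B n (suc j) + (1ℚ * B n j + ∑< j (λ b → 0ℚ * B n (j ∸ suc b)))
    ≡⟨ cong (λ s → 0ℚ * B n (suc j) + (1ℚ * B n j + s)) (∑<-zero j (λ b _ → *-zeroˡ (B n (j ∸ suc b)))) ⟩
  0ℚ * B n (suc j) + (1ℚ * B n j + 0ℚ)
    ≡⟨ solve 2 (λ x y → con 0ℚ :* x :+ (con 1ℚ :* y :+ con 0ℚ) := y) refl (B n (suc j)) (B n j) ⟩
  B n j ∎
  where open ≡-Reasoning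

[𝟙⊖𝕪]⊛-zero : ∀ B n → ((𝟙 ⊖ 𝕪) ⊛ B) n 0 ≡ B n 0
[𝟙⊖𝕪]⊛-zero B n = trans (⊛-row₀ (𝟙 ⊖ 𝕪) B (λ _ _ → refl) n 0) (solve 1 (λ x → con 1ℚ :* x :+ con 0ℚ := x) refl (B n 0))

[𝟙⊖𝕪]⊛-suc : ∀ B n j → ((𝟙 ⊖ 𝕪) ⊛ B) n (suc j) ≡ B n (suc j) - B n j
[𝟙⊖𝕪]⊛-suc B n j = begin
  ((𝟙 ⊖ 𝕪) ⊛ B) n (suc j)
    ≡⟨ ⊛-row₀ (𝟙 ⊖ 𝕪) B (λ _ _ → refl) n (suc j) ⟩
  1ℚ * B n (suc j) + ((- 1ℚ) * B n j + ∑< j (λ b → 0ℚ * B n (j ∸ suc b)))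
    ≡⟨ cong (λ s → 1ℚ * B n (suc j) + ((- 1ℚ) * B n j + s)) (∑<-zero j (λ b _ → *-zeroˡ (B n (j ∸ suc b)))) ⟩
  1ℚ * B n (suc j) + ((- 1ℚ) * B n j + 0ℚ)
    ≡⟨ solve 2 (λ x y → con 1ℚ :* x :+ (con (- 1ℚ) :* y :+ con 0ℚ) := x :- y) refl (B n (suc j)) (B n j) ⟩
  B n (suc j) - B n j ∎
  where open ≡-Reasoning

𝕪⊛-assoc : ∀ A B n j → ((𝕪 ⊛ A) ⊛ B) n j ≡ (𝕪 ⊛ (A ⊛ B)) n j
𝕪⊛-assoc A B n zero = begin
  ((𝕪 ⊛ A) ⊛ B) n 0
    ≡⟨ ⊛-∑< (𝕪 ⊛ A) B n 0 ⟩
  ∑< (suc n) (λ a → (𝕪 ⊛ A) a 0 * B (n ∸ a) 0 + 0ℚ)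
    ≡⟨ ∑<-zero (suc n) (λ a _ → trans (cong (λ x → x * B (n ∸ a) 0 + 0ℚ) (𝕪⊛-zero A a))
                                      (solve 1 (λ x → con 0ℚ :* x :+ con 0ℚ := con 0ℚ) refl (B (n ∸ a) 0))) ⟩
  0ℚ
    ≡⟨ 𝕪⊛-zero (A ⊛ B) n ⟨
  (𝕪 ⊛ (A ⊛ B)) n 0 ∎
  where open ≡-Reasoning
𝕪⊛-assoc A B n (suc j) = begin
  ((𝕪 ⊛ A) ⊛ B) n (suc j)
    ≡⟨ ⊛-∑< (𝕪 ⊛ A) B n (suc j) ⟩
  ∑< (suc n) (λ a → (𝕪 ⊛ A) a 0 * B (n ∸ a) (suc j) + ∑< (suc j) (λ b → (𝕪 ⊛ A) a (suc b) * B (n ∸ a) (j ∸ b)))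
    ≡⟨ ∑<-cong (suc n) (λ a _ → cong₂ _+_ (trans (cong (_* B (n ∸ a) (suc j)) (𝕪⊛-zero A a)) (*-zeroˡ (B (n ∸ a) (suc j))))
                                          (∑<-cong (suc j) (λ b _ → cong (_* B (n ∸ a) (j ∸ b)) (𝕪⊛-suc A a b)))) ⟩
  ∑< (suc n) (λ a → 0ℚ + ∑< (suc j) (λ b → A a b * B (n ∸ a) (j ∸ b)))
    ≡⟨ ∑<-cong (suc n) (λ a _ → +-identityˡ (∑< (suc j) (λ b → A a b * B (n ∸ a) (j ∸ b)))) ⟩
  ∑< (suc n) (λ a → ∑< (suc j) (λ b → A a b * B (n ∸ a) (j ∸ b)))
    ≡⟨ ⊛-∑< A B n j ⟨
  (A ⊛ B) n j
    ≡⟨ 𝕪⊛-suc (A ⊛ B) n j ⟨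
  (𝕪 ⊛ (A ⊛ B)) n (suc j) ∎
  where open ≡-Reasoning

module Derivative (k : ℕ) where

  open Counting k

  P-occCount : ∀ n j → P k n j ≡ ι (occCount 0 j (S n)) * 1/! n
  P-occCount n j = trans (cong (λ c → (ℤ.+ c / n !) {{n ℕ.!≢0}}) (length-filter-≟ (occ k) j (S n))) (/!≡ι*1/! (occCount 0 j (S n)) n)

  -- The coefficients of Q from the header.
  Q : FPS₂
  Q a b = ι (occCount (χ (k ≤? a)) b (S a)) * 1/! a

  binomialSum-egf : ∀ n H → ι (binomialSum n H) * 1/! n ≡ ∑< (suc n) (λ a → ι (H (n ∸ a) a) * (1/! a * 1/! (n ∸ a)))
  binomialSum-egf n H = begin
    ι (binomialSum n H) * 1/! n                                   ≡⟨ cong (_* 1/! n) (ι-∑< (suc n) (λ a → (n C a) ℕ.* H (n ∸ a) a)) ⟩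
    ∑< (suc n) (λ a → ι ((n C a) ℕ.* H (n ∸ a) a)) * 1/! n        ≡⟨ *-distribʳ-∑< (suc n) (λ a → ι ((n C a) ℕ.* H (n ∸ a) a)) (1/! n) ⟩
    ∑< (suc n) (λ a → ι ((n C a) ℕ.* H (n ∸ a) a) * 1/! n)        ≡⟨ ∑<-cong (suc n) term ⟩
    ∑< (suc n) (λ a → ι (H (n ∸ a) a) * (1/! a * 1/! (n ∸ a)))    ∎
    where
    open ≡-Reasoning
    term : ∀ a → a < suc n → ι ((n C a) ℕ.* H (n ∸ a) a) * 1/! n ≡ ι (H (n ∸ a) a) * (1/! a * 1/! (n ∸ a))
    term a (s≤s a≤n) = begin
      ι ((n C a) ℕ.* H (n ∸ a) a) * 1/! n              ≡⟨ cong (_* 1/! n) (ι-* (n C a) (H (n ∸ a) a)) ⟩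
      ι (n C a) * ι (H (n ∸ a) a) * 1/! n              ≡⟨ solve 3 (λ c h u → c :* h :* u := h :* (c :* u)) refl (ι (n C a)) (ι (H (n ∸ a) a)) (1/! n) ⟩
      ι (H (n ∸ a) a) * (ι (n C a) * 1/! n)            ≡⟨ cong (ι (H (n ∸ a) a) *_) (1/!-binomial {n} {a} (binomial-factorials a≤n)) ⟨
      ι (H (n ∸ a) a) * (1/! a * 1/! (n ∸ a))          ∎

  ∂x-P : ∀ n j → ∂x (P k) n j ≡ (Q ⊛ P k) n j
  ∂x-P n j = begin
    ι (suc n) * P k (suc n) j
      ≡⟨ cong (ι (suc n) *_) (P-occCount (suc n) j) ⟩
    ι (suc n) * (ι (occCount 0 j (S (suc n))) * 1/! (suc n))
      ≡⟨ solve 3 (λ s c u → s :* (c :* u) := c :* (s :* u)) refl (ι (suc n)) (ι (occCount 0 j (S (suc n)))) (1/! (suc n)) ⟩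
    ι (occCount 0 j (S (suc n))) * (ι (suc n) * 1/! (suc n))
      ≡⟨ cong₂ (λ c u → ι c * u) (occCount-S-suc n j) (ι-suc*1/!-suc n) ⟩
    ι (binomialSum n H) * 1/! n
      ≡⟨ binomialSum-egf n H ⟩
    ∑< (suc n) (λ a → ι (H (n ∸ a) a) * (1/! a * 1/! (n ∸ a)))
      ≡⟨ ∑<-cong (suc n) (λ a _ → term a) ⟩
    ∑< (suc n) (λ a → ∑< (suc j) (λ b → Q a b * P k (n ∸ a) (j ∸ b)))
      ≡⟨ ⊛-∑< Q (P k) n j ⟨
    (Q ⊛ P k) n j ∎
    where
    open ≡-Reasoning
    H : ℕ → ℕ → ℕ
    H x y = NatSums.∑< (suc j) (λ b → occCount (χ (k ≤? y)) b (S y) ℕ.* occCount 0 (j ∸ b) (S x))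
    term : ∀ a → ι (H (n ∸ a) a) * (1/! a * 1/! (n ∸ a)) ≡ ∑< (suc j) (λ b → Q a b * P k (n ∸ a) (j ∸ b))
    term a = begin
      ι (H (n ∸ a) a) * (1/! a * 1/! (n ∸ a))
        ≡⟨ cong (_* (1/! a * 1/! (n ∸ a))) (ι-∑< (suc j) (λ b → c⁺ b ℕ.* c (j ∸ b))) ⟩
      ∑< (suc j) (λ b → ι (c⁺ b ℕ.* c (j ∸ b))) * (1/! a * 1/! (n ∸ a))
        ≡⟨ *-distribʳ-∑< (suc j) (λ b → ι (c⁺ b ℕ.* c (j ∸ b))) (1/! a * 1/! (n ∸ a)) ⟩
      ∑< (suc j) (λ b → ι (c⁺ b ℕ.* c (j ∸ b)) * (1/! a * 1/! (n ∸ a)))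
        ≡⟨ ∑<-cong (suc j) (λ b _ → factor b) ⟩
      ∑< (suc j) (λ b → Q a b * P k (n ∸ a) (j ∸ b)) ∎
      where
      c⁺ c : ℕ → ℕ
      c⁺ b = occCount (χ (k ≤? a)) b (S a)
      c  b = occCount 0 b (S (n ∸ a))
      factor : ∀ b → ι (c⁺ b ℕ.* c (j ∸ b)) * (1/! a * 1/! (n ∸ a)) ≡ Q a b * P k (n ∸ a) (j ∸ b)
      factor b = begin
        ι (c⁺ b ℕ.* c (j ∸ b)) * (1/! a * 1/! (n ∸ a))
          ≡⟨ cong (_* (1/! a * 1/! (n ∸ a))) (ι-* (c⁺ b) (c (j ∸ b))) ⟩
        ι (c⁺ b) * ι (c (j ∸ b)) * (1/! a * 1/! (n ∸ a))
          ≡⟨ solve 4 (λ x y u v → x :* y :* (u :* v) := x :* u :* (y :* v)) refl (ι (c⁺ b)) (ι (c (j ∸ b))) (1/! a) (1/! (n ∸ a)) ⟩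
        Q a b * (ι (c (j ∸ b)) * 1/! (n ∸ a))
          ≡⟨ cong (Q a b *_) (P-occCount (n ∸ a) (j ∸ b)) ⟨
        Q a b * P k (n ∸ a) (j ∸ b) ∎

  P-short-zero : ∀ {a} → a < k → P k a 0 ≡ 1ℚ
  P-short-zero {a} a<k = trans (P-occCount a 0) (trans (cong (λ c → ι c * 1/! a) (occCount-S-short-zero a a<k)) (ι-!*1/! a))

  P-short-suc : ∀ {a} b → a ≤ k → P k a (suc b) ≡ 0ℚ
  P-short-suc {a} b a≤k = trans (P-occCount a (suc b)) (trans (cong (λ c → ι c * 1/! a) (occCount-S-short-suc b a≤k)) (*-zeroˡ (1/! a)))

  Q-short : ∀ {a} b → a < k → Q a b ≡ P k a b
  Q-short {a} b a<k = trans (cong (λ d → ι (occCount d b (S a)) * 1/! a) (χ-no (k ≤? a) (<⇒≱ a<k))) (sym (P-occCount a b))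

  Q-long-zero : ∀ {a} → k ≤ a → Q a 0 ≡ 0ℚ
  Q-long-zero {a} k≤a = begin
    ι (occCount (χ (k ≤? a)) 0 (S a)) * 1/! a   ≡⟨ cong (λ d → ι (occCount d 0 (S a)) * 1/! a) (χ-yes (k ≤? a) k≤a) ⟩
    ι (occCount 1 0 (S a)) * 1/! a              ≡⟨ cong (λ c → ι c * 1/! a) (∑∈-zero (S a)) ⟩
    0ℚ * 1/! a                                  ≡⟨ *-zeroˡ (1/! a) ⟩
    0ℚ                                          ∎
    where open ≡-Reasoning

  Q-long-suc : ∀ {a} b → k ≤ a → Q a (suc b) ≡ P k a b
  Q-long-suc {a} b k≤a = trans (cong (λ d → ι (occCount d (suc b) (S a)) * 1/! a) (χ-yes (k ≤? a) k≤a)) (sym (P-occCount a b))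

  geomX-short : ∀ {a} → a < k → geomX k a 0 ≡ 1ℚ
  geomX-short {a} a<k with a <? k
  ... | yes _   = refl
  ... | no  a≮k = ⊥-elim (a≮k a<k)

  geomX-long : ∀ {a} b → k ≤ a → geomX k a b ≡ 0ℚ
  geomX-long {a} zero    k≤a with a <? k
  ... | yes a<k = ⊥-elim (<⇒≱ a<k k≤a)
  ... | no  _   = refl
  geomX-long     (suc b) _   = refl

  G : FPS₂
  G = (𝟙 ⊖ 𝕪) ⊛ geomX k

  P-short≡geomX : ∀ {a} b → a < k → P k a b ≡ geomX k a b
  P-short≡geomX zero    a<k = trans (P-short-zero a<k) (sym (geomX-short a<k))
  P-short≡geomX (suc b) a<k = P-short-suc b (<⇒≤ a<k)

  Q-decomposition-short : ∀ {a} b → a < k → Q a b ≡ ((𝕪 ⊛ P k) ⊕ G) a b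
  Q-decomposition-short {a} zero    a<k = begin
    Q a 0                             ≡⟨ trans (Q-short 0 a<k) (P-short≡geomX 0 a<k) ⟩
    geomX k a 0                       ≡⟨ +-identityˡ (geomX k a 0) ⟨
    0ℚ + geomX k a 0                  ≡⟨ cong₂ _+_ (𝕪⊛-zero (P k) a) ([𝟙⊖𝕪]⊛-zero (geomX k) a) ⟨
    (𝕪 ⊛ P k) a 0 + G a 0             ∎
    where open ≡-Reasoning
  Q-decomposition-short {a} (suc b) a<k = begin
    Q a (suc b)                                       ≡⟨ trans (Q-short (suc b) a<k) (P-short≡geomX (suc b) a<k) ⟩
    geomX k a (suc b)                                 ≡⟨ solve 2 (λ g g′ → g′ := g :+ (g′ :- g)) refl (geomX k a b) (geomX k a (suc b)) ⟩
    geomX k a b + (geomX k a (suc b) - geomX k a b)   ≡⟨ cong₂ _+_ (trans (𝕪⊛-suc (P k) a b) (P-short≡geomX b a<k)) ([𝟙⊖𝕪]⊛-suc (geomX k) a b) ⟨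
    (𝕪 ⊛ P k) a (suc b) + G a (suc b)                 ∎
    where open ≡-Reasoning

  Q-decomposition-long : ∀ {a} b → k ≤ a → Q a b ≡ ((𝕪 ⊛ P k) ⊕ G) a b
  Q-decomposition-long {a} zero    k≤a = begin
    Q a 0                             ≡⟨ trans (Q-long-zero k≤a) (sym (geomX-long 0 k≤a)) ⟩
    geomX k a 0                       ≡⟨ +-identityˡ (geomX k a 0) ⟨
    0ℚ + geomX k a 0                  ≡⟨ cong₂ _+_ (𝕪⊛-zero (P k) a) ([𝟙⊖𝕪]⊛-zero (geomX k) a) ⟨
    (𝕪 ⊛ P k) a 0 + G a 0             ∎
    where open ≡-Reasoning
  Q-decomposition-long {a} (suc b) k≤a = begin
    Q a (suc b)                                       ≡⟨ Q-long-suc b k≤a ⟩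
    P k a b                                           ≡⟨ +-identityʳ (P k a b) ⟨
    P k a b + 0ℚ                                      ≡⟨ cong (P k a b +_) (+-inverseʳ (geomX k a b)) ⟨
    P k a b + (geomX k a b - geomX k a b)             ≡⟨ cong (λ g → P k a b + (g - geomX k a b)) (trans (geomX-long b k≤a) (sym (geomX-long (suc b) k≤a))) ⟩
    P k a b + (geomX k a (suc b) - geomX k a b)       ≡⟨ cong₂ _+_ (𝕪⊛-suc (P k) a b) ([𝟙⊖𝕪]⊛-suc (geomX k) a b) ⟨
    (𝕪 ⊛ P k) a (suc b) + G a (suc b)                 ∎
    where open ≡-Reasoning

  Q-decomposition : ∀ a b → Q a b ≡ ((𝕪 ⊛ P k) ⊕ G) a b
  Q-decomposition a b = by-cases (a <? k)
    where
    by-cases : Dec (a < k) → Q a b ≡ ((𝕪 ⊛ P k) ⊕ G) a b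
    by-cases (yes a<k) = Q-decomposition-short b a<k
    by-cases (no  a≮k) = Q-decomposition-long b (≮⇒≥ a≮k)

  P-at-0 : ∀ j → atX0 (P k) j ≡ atX0 𝟙 j
  P-at-0 zero    = refl
  P-at-0 (suc j) = refl

mainTheorem5 : (k : ℕ) → 1 ≤ k →
    (∀ n j → ∂x (P k) n j ≡ ((𝕪 ⊛ (P k ⊛ P k)) ⊕ (((𝟙 ⊖ 𝕪) ⊛ geomX k) ⊛ P k)) n j)
    × (∀ j → atX0 (P k) j ≡ atX0 𝟙 j)
mainTheorem5 k _ = ode , P-at-0
  where
  open Derivative k
  ode : ∀ n j → ∂x (P k) n j ≡ ((𝕪 ⊛ (P k ⊛ P k)) ⊕ (G ⊛ P k)) n j
  ode n j = begin
    ∂x (P k) n j                              ≡⟨ ∂x-P n j ⟩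
    (Q ⊛ P k) n j                             ≡⟨ ⊛-congˡ (P k) Q-decomposition n j ⟩
    (((𝕪 ⊛ P k) ⊕ G) ⊛ P k) n j               ≡⟨ ⊛-distribʳ-⊕ (𝕪 ⊛ P k) G (P k) n j ⟩
    ((𝕪 ⊛ P k) ⊛ P k) n j + (G ⊛ P k) n j     ≡⟨ cong (_+ (G ⊛ P k) n j) (𝕪⊛-assoc (P k) (P k) n j) ⟩
    (𝕪 ⊛ (P k ⊛ P k)) n j + (G ⊛ P k) n j     ∎
    where open ≡-Reasoning
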